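{- Let $a_n$, $s$ and $c$ be any integers and let $n$ be a positive integer. Then \[ \sum_{a_{n-1}=c}^{a_n}\sum_{a_{n-2}=c}^{a_{n-1}}\cdots\sum_{a_0=c}^{a_1}F_{3a_0+s}=\frac{F_{2n+3a_n+s}}{2^n}-\sum_{j=0}^{n-1}\frac{F_{2(n-j)+3(c-1)+s}}{2^{n-j}}\binom{a_n+j-c}{j}, \] and \[ \sum_{a_{n-1}=c}^{a_n}\sum_{a_{n-2}=c}^{a_{n-1}}\cdots\sum_{a_0=c}^{a_1}L_{3a_0+s}=\frac{L_{2n+3a_n+s}}{2^n}-\sum_{j=0}^{n-1}\frac{L_{2(n-j)+3(c-1)+s}}{2^{n-j}}\binom{a_n+j-c}{j}. \]
   Context: $F_j$ and $L_j$ are the Fibonacci and Lucas numbers: $F_0=0$, $F_1=1$, $L_0=2$, $L_1=1$, and both satisfy $X_j=X_{j-1}+X_{j-2}$, extended to all integer indices by this recurrence. The left sides are iterated sums with $n$ summation signs: $a_{n-1}$ runs from $c$ to $a_n$, and for each $i$ the index $a_{i-1}$ runs from $c$ to $a_i$. Summation convention: for integers $m,M$, $\sum_{k=m}^{M}h(k)$ is the usual sum if $M\ge m$, equals $0$ if $M=m-1$, and equals $-\sum_{k=M+1}^{m-1}h(k)$ if $M\le m-2$. For an integer $N$ and a non-negative integer $j$, $\binom{N}{j}=N(N-1)\cdots(N-j+1)/j!$. -}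

module Defs where

open import Data.Nat as ℕ using (ℕ; zero; suc; _!; _^_)
open import Data.Nat.Properties using (m^n≢0; _!≢0)
open import Data.Integer as ℤ using (ℤ; +_; -[1+_])
open import Data.Product using (_×_; _,_; proj₁; proj₂)
open import Data.Rational as ℚ using (ℚ; 0ℚ)

-- A sequence X : ℤ → ℤ with X 0 = x0, X 1 = x1 and X j = X (j-1) + X (j-2)
-- for all integers j (extended to negative indices by the recurrence,
-- i.e. X (j-2) = X j - X (j-1)).

-- forward m = (X m , X (m+1))
forward : ℤ → ℤ → ℕ → ℤ × ℤ
forward x0 x1 zero = x0 , x1
forward x0 x1 (suc m) with forward x0 x1 m
... | (a , b) = b , a ℤ.+ b

-- backward m = (X (-m-1) , X (-m))
backward : ℤ → ℤ → ℕ → ℤ × ℤ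
backward x0 x1 zero = x1 ℤ.- x0 , x0
backward x0 x1 (suc m) with backward x0 x1 m
... | (a , b) = b ℤ.- a , a

recSeq : ℤ → ℤ → ℤ → ℤ
recSeq x0 x1 (+ m) = proj₁ (forward x0 x1 m)
recSeq x0 x1 -[1+ m ] = proj₁ (backward x0 x1 m)

F : ℤ → ℤ
F = recSeq (+ 0) (+ 1)

L : ℤ → ℤ
L = recSeq (+ 2) (+ 1)

sumFrom : (ℤ → ℚ) → ℤ → ℕ → ℚ
sumFrom h c zero = 0ℚ
sumFrom h c (suc m) = h c ℚ.+ sumFrom h (c ℤ.+ + 1) m

-- Σ_{k=m}^{M} h k with the paper's convention:
--   usual sum if M ≥ m, 0 if M = m-1, - Σ_{k=M+1}^{m-1} h k if M ≤ m-2.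
sumZ : ℤ → ℤ → (ℤ → ℚ) → ℚ
sumZ m M h with M ℤ.- m ℤ.+ + 1
... | + k = sumFrom h m k
... | -[1+ k ] = ℚ.- sumFrom h (M ℤ.+ + 1) (suc k)

-- iterSum c k f a  =  Σ_{b_{k-1}=c}^{a} Σ_{b_{k-2}=c}^{b_{k-1}} ⋯ Σ_{b_0=c}^{b_1} f b_0
-- (k summation signs; iterSum c 0 f a = f a)
iterSum : ℤ → ℕ → (ℤ → ℚ) → ℤ → ℚ
iterSum c zero f a = f a
iterSum c (suc k) f a = sumZ c a (iterSum c k f)

fallingℤ : ℤ → ℕ → ℤ
fallingℤ N zero = + 1
fallingℤ N (suc j) = fallingℤ N j ℤ.* (N ℤ.- + j)

binomℤ : ℤ → ℕ → ℚ
binomℤ N j = (fallingℤ N j ℚ./ (j !)) {{j !≢0}}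

div2^ : ℤ → ℕ → ℚ
div2^ x k = (x ℚ./ (2 ^ k)) {{m^n≢0 2 k}}

sumBelow : ℕ → (ℕ → ℚ) → ℚ
sumBelow zero g = 0ℚ
sumBelow (suc n) g = sumBelow n g ℚ.+ g n

toℚ : ℤ → ℚ
toℚ x = x ℚ./ 1

-- For any X obeying the Fibonacci recurrence, X (m + 2) − X (m − 1) = 2 X m.  Hence, as a
-- function of x = aₙ, the leading term X (2n + 3x + s) / 2ⁿ of the right-hand side has as
-- backward difference the leading term for n − 1, and by Pascal's rule the same holds for the
-- correction sum; so the right-hand side for n is the backward difference in x of the one for
-- n + 1.  At x = c − 1 every binomial but the j = 0 one vanishes, so there the right-hand side
-- for n + 1 is 0.  A sum of backward differences telescopes (with either orientation of the
-- summation range), so summing the right-hand side for n over c ≤ a ≤ x gives the one for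
-- n + 1, and induction on n starting from X (3x + s) proves both identities.
module Submission where

open import Defs
open import Data.Nat using (ℕ; _∸_; NonZero)
open import Data.Integer using (ℤ; +_; _+_; _-_; _*_)
open import Data.Rational using (ℚ) renaming (_*_ to _*ℚ_; _-_ to _-ℚ_)
open import Data.Product using (_×_)
open import Relation.Binary.PropositionalEquality using (_≡_)

open import Data.Nat as ℕ using (zero; suc; _!; _^_)
import Data.Nat.Properties as ℕP
open import Data.Integer using (-_; -[1+_])
import Data.Integer.Properties as ℤP
open import Data.Integer.Tactic.RingSolver using (solve-∀)
import Data.Rational as ℚ
open import Data.Rational using (0ℚ; 1ℚ; _/_; toℚᵘ) renaming (_+_ to _+ℚ_)
open import Data.Rational.Properties
  using (toℚᵘ-injective; toℚᵘ-fromℚᵘ; fromℚᵘ-cong; toℚᵘ-homo-+; toℚᵘ-homo‿-;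
         +-identityˡ; +-identityʳ; +-assoc; +-inverseʳ; *-identityʳ; *-zeroʳ; 0/n≡0)
open import Data.Rational.Solver using (module +-*-Solver)
open import Data.Rational.Unnormalised using (mkℚᵘ; _≃_)
  renaming (_/_ to _/ᵘ_; _+_ to _+ᵘ_; _-_ to _-ᵘ_)
import Data.Rational.Unnormalised.Properties as ℚᵘP
open import Data.Product using (_,_)
open import Relation.Binary.PropositionalEquality using (refl; sym; trans; cong; cong₂; module ≡-Reasoning)

open +-*-Solver using (solve; _:+_; _:*_; _:-_; :-_; _:=_)

toℚᵘ-/ : ∀ x d .{{_ : NonZero d}} → toℚᵘ (x / d) ≃ x /ᵘ d
toℚᵘ-/ x (suc d) = toℚᵘ-fromℚᵘ (mkℚᵘ x d)

/-cong-≃ : ∀ {x y d e} .{{_ : NonZero d}} .{{_ : NonZero e}} → x /ᵘ d ≃ y /ᵘ e → x / d ≡ y / e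
/-cong-≃ {d = suc _} {e = suc _} = fromℚᵘ-cong

/ᵘ-sub : ∀ x y d .{{_ : NonZero d}} → (x /ᵘ d) -ᵘ (y /ᵘ d) ≃ (x - y) /ᵘ d
/ᵘ-sub x y d@(suc _) = ℚᵘP.≃-trans
  (ℚᵘP.≃-reflexive (ℚᵘP./-cong {{ℕP.m*n≢0 d d}} {{ℕP.m*n≢0 d d}} (distrib x y (+ d)) refl))
  (ℚᵘP.*-cancelʳ-/ d {{_}} {{ℕP.m*n≢0 d d}})
  where
  distrib : ∀ x y k → x * k + - y * k ≡ (x - y) * k
  distrib = solve-∀

/-sub : ∀ x y d .{{_ : NonZero d}} → x / d -ℚ y / d ≡ (x - y) / d
/-sub x y d = toℚᵘ-injective (begin
  toℚᵘ (x / d -ℚ y / d)               ≈⟨ toℚᵘ-homo-+ (x / d) (ℚ.- (y / d)) ⟩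
  toℚᵘ (x / d) +ᵘ toℚᵘ (ℚ.- (y / d))  ≈⟨ ℚᵘP.+-cong (toℚᵘ-/ x d) (ℚᵘP.≃-trans (toℚᵘ-homo‿- (y / d)) (ℚᵘP.-‿cong (toℚᵘ-/ y d))) ⟩
  (x /ᵘ d) -ᵘ (y /ᵘ d)                ≈⟨ /ᵘ-sub x y d ⟩
  (x - y) /ᵘ d                        ≈⟨ ℚᵘP.≃-sym (toℚᵘ-/ (x - y) d) ⟩
  toℚᵘ ((x - y) / d)                  ∎)
  where open ℚᵘP.≃-Reasoning

*-cancelˡ-/ : ∀ p {q r} .{{_ : NonZero r}} .{{_ : NonZero (p ℕ.* r)}} → (+ p * q) / (p ℕ.* r) ≡ q / r
*-cancelˡ-/ p = /-cong-≃ (ℚᵘP.*-cancelˡ-/ p)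

sumFrom-cong : ∀ {h g : ℤ → ℚ} → (∀ x → h x ≡ g x) → ∀ c k → sumFrom h c k ≡ sumFrom g c k
sumFrom-cong h≗g c zero    = refl
sumFrom-cong h≗g c (suc k) = cong₂ _+ℚ_ (h≗g c) (sumFrom-cong h≗g (c + + 1) k)

sumZ-cong : ∀ {h g : ℤ → ℚ} → (∀ x → h x ≡ g x) → ∀ c a → sumZ c a h ≡ sumZ c a g
sumZ-cong h≗g c a with a - c + + 1
... | + k      = sumFrom-cong h≗g c k
... | -[1+ k ] = cong ℚ.-_ (sumFrom-cong h≗g (a + + 1) (suc k))

module _ (h H : ℤ → ℚ) (h≡∇H : ∀ x → h x ≡ H x -ℚ H (x - + 1)) where

  sumFrom-telescope : ∀ b k → sumFrom h (b + + 1) k ≡ H (b + + k) -ℚ H b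
  sumFrom-telescope b zero = begin
    0ℚ                   ≡⟨ sym (+-inverseʳ (H b)) ⟩
    H b -ℚ H b           ≡⟨ cong (λ t → H t -ℚ H b) (sym (ℤP.+-identityʳ b)) ⟩
    H (b + + 0) -ℚ H b   ∎
    where open ≡-Reasoning
  sumFrom-telescope b (suc k) = begin
    h (b + + 1) +ℚ sumFrom h (b + + 1 + + 1) k
      ≡⟨ cong₂ _+ℚ_ (h≡∇H (b + + 1)) (sumFrom-telescope (b + + 1) k) ⟩
    (H (b + + 1) -ℚ H (b + + 1 - + 1)) +ℚ (H (b + + 1 + + k) -ℚ H (b + + 1))
      ≡⟨ cong₂ (λ u v → (H (b + + 1) -ℚ H u) +ℚ (H v -ℚ H (b + + 1))) (+1-1 b) (ℤP.+-assoc b (+ 1) (+ k)) ⟩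
    (H (b + + 1) -ℚ H b) +ℚ (H (b + + suc k) -ℚ H (b + + 1))
      ≡⟨ chain (H (b + + 1)) (H b) (H (b + + suc k)) ⟩
    H (b + + suc k) -ℚ H b ∎
    where
    open ≡-Reasoning
    +1-1 : ∀ b → b + + 1 - + 1 ≡ b
    +1-1 = solve-∀
    chain : ∀ p q r → (p -ℚ q) +ℚ (r -ℚ p) ≡ r -ℚ q
    chain = solve 3 (λ p q r → (p :- q) :+ (r :- p) := r :- q) refl

  sumZ-telescope : ∀ c a → sumZ c a h ≡ H a -ℚ H (c - + 1)
  sumZ-telescope c a with a - c + + 1 in len
  ... | + k = begin
    sumFrom h c k                        ≡⟨ cong (λ t → sumFrom h t k) (sym (-1+1 c)) ⟩
    sumFrom h (c - + 1 + + 1) k          ≡⟨ sumFrom-telescope (c - + 1) k ⟩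
    H (c - + 1 + + k) -ℚ H (c - + 1)     ≡⟨ cong (λ t → H (c - + 1 + t) -ℚ H (c - + 1)) (sym len) ⟩
    H (c - + 1 + (a - c + + 1)) -ℚ H (c - + 1) ≡⟨ cong (λ t → H t -ℚ H (c - + 1)) (end a c) ⟩
    H a -ℚ H (c - + 1)                   ∎
    where
    open ≡-Reasoning
    -1+1 : ∀ c → c - + 1 + + 1 ≡ c
    -1+1 = solve-∀
    end : ∀ a c → c - + 1 + (a - c + + 1) ≡ a
    end = solve-∀
  ... | -[1+ k ] = begin
    ℚ.- sumFrom h (a + + 1) (suc k)        ≡⟨ cong ℚ.-_ (sumFrom-telescope a (suc k)) ⟩
    ℚ.- (H (a + + suc k) -ℚ H a)           ≡⟨ cong (λ t → ℚ.- (H (a - t) -ℚ H a)) (sym len) ⟩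
    ℚ.- (H (a - (a - c + + 1)) -ℚ H a)     ≡⟨ cong (λ t → ℚ.- (H t -ℚ H a)) (end a c) ⟩
    ℚ.- (H (c - + 1) -ℚ H a)               ≡⟨ flip (H (c - + 1)) (H a) ⟩
    H a -ℚ H (c - + 1)                    ∎
    where
    open ≡-Reasoning
    end : ∀ a c → a - (a - c + + 1) ≡ c - + 1
    end = solve-∀
    flip : ∀ p q → ℚ.- (p -ℚ q) ≡ q -ℚ p
    flip = solve 2 (λ p q → :- (p :- q) := q :- p) refl

sumBelow-cong : ∀ n {g g′ : ℕ → ℚ} → (∀ j → g j ≡ g′ j) → sumBelow n g ≡ sumBelow n g′
sumBelow-cong zero    g≗g′ = refl
sumBelow-cong (suc n) g≗g′ = cong₂ _+ℚ_ (sumBelow-cong n g≗g′) (g≗g′ n)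

sumBelow-zero : ∀ n → sumBelow n (λ _ → 0ℚ) ≡ 0ℚ
sumBelow-zero zero    = refl
sumBelow-zero (suc n) = cong (_+ℚ 0ℚ) (sumBelow-zero n)

sumBelow-suc : ∀ n (g : ℕ → ℚ) → sumBelow (suc n) g ≡ g 0 +ℚ sumBelow n (λ j → g (suc j))
sumBelow-suc zero    g = trans (+-identityˡ (g 0)) (sym (+-identityʳ (g 0)))
sumBelow-suc (suc n) g = trans (cong (_+ℚ g (suc n)) (sumBelow-suc n g)) (+-assoc (g 0) _ _)

sumBelow-sub : ∀ n (g g′ : ℕ → ℚ) → sumBelow n g -ℚ sumBelow n g′ ≡ sumBelow n (λ j → g j -ℚ g′ j)
sumBelow-sub zero    g g′ = refl
sumBelow-sub (suc n) g g′ =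
  trans (interchange (sumBelow n g) (g n) (sumBelow n g′) (g′ n)) (cong (_+ℚ (g n -ℚ g′ n)) (sumBelow-sub n g g′))
  where
  interchange : ∀ p q r t → (p +ℚ q) -ℚ (r +ℚ t) ≡ (p -ℚ r) +ℚ (q -ℚ t)
  interchange = solve 4 (λ p q r t → (p :+ q) :- (r :+ t) := (p :- r) :+ (q :- t)) refl

fallingℤ-suc : ∀ N j → fallingℤ N (suc j) ≡ N * fallingℤ (N - + 1) j
fallingℤ-suc N zero = lemma N
  where
  lemma : ∀ N → + 1 * (N - + 0) ≡ N * + 1
  lemma = solve-∀
fallingℤ-suc N (suc j) =
  trans (cong (_* (N - + suc j)) (fallingℤ-suc N j)) (lemma N (fallingℤ (N - + 1) j) (+ j))
  where
  lemma : ∀ N f j → N * f * (N - (+ 1 + j)) ≡ N * (f * (N - + 1 - j))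
  lemma = solve-∀

fallingℤ-pascal : ∀ N j → fallingℤ N (suc j) - fallingℤ (N - + 1) (suc j) ≡ + suc j * fallingℤ (N - + 1) j
fallingℤ-pascal N j =
  trans (cong (_- fallingℤ (N - + 1) (suc j)) (fallingℤ-suc N j)) (lemma N (fallingℤ (N - + 1) j) (+ j))
  where
  lemma : ∀ N f j → N * f - f * (N - + 1 - j) ≡ (+ 1 + j) * f
  lemma = solve-∀

binomℤ-pascal : ∀ N j → binomℤ N (suc j) -ℚ binomℤ (N - + 1) (suc j) ≡ binomℤ (N - + 1) j
binomℤ-pascal N j = begin
  binomℤ N (suc j) -ℚ binomℤ (N - + 1) (suc j)
    ≡⟨ /-sub (fallingℤ N (suc j)) (fallingℤ (N - + 1) (suc j)) (suc j !) ⟩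
  (fallingℤ N (suc j) - fallingℤ (N - + 1) (suc j)) / suc j !
    ≡⟨ cong (_/ suc j !) (fallingℤ-pascal N j) ⟩
  (+ suc j * fallingℤ (N - + 1) j) / suc j !
    ≡⟨ *-cancelˡ-/ (suc j) {fallingℤ (N - + 1) j} {j !} ⟩
  binomℤ (N - + 1) j ∎
  where
  open ≡-Reasoning
  instance
    j!≢0 : NonZero (j !)
    j!≢0 = j ℕP.!≢0
    [1+j]!≢0 : NonZero (suc j !)
    [1+j]!≢0 = suc j ℕP.!≢0

binomℤ[n,1+n]≡0 : ∀ n → binomℤ (+ n) (suc n) ≡ 0ℚ
binomℤ[n,1+n]≡0 n = begin
  (fallingℤ (+ n) n * (+ n - + n)) / suc n !  ≡⟨ cong (λ t → (fallingℤ (+ n) n * t) / suc n !) (ℤP.+-inverseʳ (+ n)) ⟩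
  (fallingℤ (+ n) n * + 0) / suc n !          ≡⟨ cong (_/ suc n !) (ℤP.*-zeroʳ (fallingℤ (+ n) n)) ⟩
  + 0 / suc n !                               ≡⟨ 0/n≡0 (suc n !) ⟩
  0ℚ                                          ∎
  where
  open ≡-Reasoning
  instance
    [1+n]!≢0 : NonZero (suc n !)
    [1+n]!≢0 = suc n ℕP.!≢0

FibonacciRecurrence : (ℤ → ℤ) → Set
FibonacciRecurrence X = ∀ k → X (k + + 2) ≡ X (k + + 1) + X k

recSeq-fibonacci : ∀ x₀ x₁ → FibonacciRecurrence (recSeq x₀ x₁)
recSeq-fibonacci x₀ x₁ (+ m) = trans (cong (λ t → recSeq x₀ x₁ (+ t)) (ℕP.+-comm m 2))
  (trans (ℤP.+-comm (recSeq x₀ x₁ (+ m)) (recSeq x₀ x₁ (+ suc m)))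
         (cong (λ t → recSeq x₀ x₁ (+ t) + recSeq x₀ x₁ (+ m)) (ℕP.+-comm 1 m)))
recSeq-fibonacci x₀ x₁ -[1+ 0 ] = lemma x₀ x₁
  where
  lemma : ∀ x₀ x₁ → x₁ ≡ x₀ + (x₁ - x₀)
  lemma = solve-∀
recSeq-fibonacci x₀ x₁ -[1+ 1 ] = lemma x₀ x₁
  where
  lemma : ∀ x₀ x₁ → x₀ ≡ (x₁ - x₀) + (x₀ - (x₁ - x₀))
  lemma = solve-∀
recSeq-fibonacci x₀ x₁ -[1+ suc (suc m) ] = lemma (recSeq x₀ x₁ -[1+ m ]) (recSeq x₀ x₁ -[1+ suc m ])
  where
  lemma : ∀ p q → p ≡ q + (p - q)
  lemma = solve-∀

fibonacci-+2--1 : ∀ {X} → FibonacciRecurrence X → ∀ m → X (m + + 2) - X (m - + 1) ≡ + 2 * X m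
fibonacci-+2--1 {X} rec m = begin
  X (m + + 2) - X (m - + 1)                    ≡⟨ cong (_- X (m - + 1)) (rec m) ⟩
  X (m + + 1) + X m - X (m - + 1)              ≡⟨ cong (λ t → X t + X m - X (m - + 1)) (shift m) ⟩
  X (m - + 1 + + 2) + X m - X (m - + 1)        ≡⟨ cong (λ t → t + X m - X (m - + 1)) (rec (m - + 1)) ⟩
  X (m - + 1 + + 1) + X (m - + 1) + X m - X (m - + 1)
                                               ≡⟨ cong (λ t → X t + X (m - + 1) + X m - X (m - + 1)) (cancel m) ⟩
  X m + X (m - + 1) + X m - X (m - + 1)        ≡⟨ collect (X m) (X (m - + 1)) ⟩
  + 2 * X m                                    ∎
  where
  open ≡-Reasoning
  shift : ∀ m → m + + 1 ≡ m - + 1 + + 2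
  shift = solve-∀
  cancel : ∀ m → m - + 1 + + 1 ≡ m
  cancel = solve-∀
  collect : ∀ p q → p + q + p - q ≡ + 2 * p
  collect = solve-∀

module ClosedForm (X : ℤ → ℤ) (rec : FibonacciRecurrence X) (s c : ℤ) where

  leading : ℕ → ℤ → ℚ
  leading n x = div2^ (X (+ (2 ℕ.* n) + + 3 * x + s)) n

  coefficient : ℕ → ℕ → ℚ
  coefficient n j = div2^ (X (+ (2 ℕ.* (n ∸ j)) + + 3 * (c - + 1) + s)) (n ∸ j)

  binomial : ℤ → ℕ → ℚ
  binomial x j = binomℤ (x + + j - c) j

  correction : ℕ → ℤ → ℚ
  correction n x = sumBelow n (λ j → coefficient n j *ℚ binomial x j)

  closedForm : ℕ → ℤ → ℚ
  closedForm n x = leading n x -ℚ correction n x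

  leading-∇ : ∀ n x → leading (suc n) x -ℚ leading (suc n) (x - + 1) ≡ leading n x
  leading-∇ n x = begin
    leading (suc n) x -ℚ leading (suc n) (x - + 1)
      ≡⟨ cong₂ (λ u v → X u / 2 ^ suc n -ℚ X v / 2 ^ suc n) index-up index-down ⟩
    X (m + + 2) / 2 ^ suc n -ℚ X (m - + 1) / 2 ^ suc n
      ≡⟨ /-sub (X (m + + 2)) (X (m - + 1)) (2 ^ suc n) ⟩
    (X (m + + 2) - X (m - + 1)) / 2 ^ suc n
      ≡⟨ cong (_/ 2 ^ suc n) (fibonacci-+2--1 {X} rec m) ⟩
    (+ 2 * X m) / (2 ℕ.* 2 ^ n)
      ≡⟨ *-cancelˡ-/ 2 {X m} {2 ^ n} ⟩
    leading n x ∎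
    where
    open ≡-Reasoning
    m = + (2 ℕ.* n) + + 3 * x + s
    instance
      2^n≢0 : NonZero (2 ^ n)
      2^n≢0 = ℕP.m^n≢0 2 n
      2^[1+n]≢0 : NonZero (2 ^ suc n)
      2^[1+n]≢0 = ℕP.m^n≢0 2 (suc n)
    2[1+n] : + (2 ℕ.* suc n) ≡ + 2 + + (2 ℕ.* n)
    2[1+n] = cong +_ (ℕP.*-suc 2 n)
    up : ∀ k x s → + 2 + k + + 3 * x + s ≡ k + + 3 * x + s + + 2
    up = solve-∀
    down : ∀ k x s → + 2 + k + + 3 * (x - + 1) + s ≡ k + + 3 * x + s - + 1
    down = solve-∀
    index-up : + (2 ℕ.* suc n) + + 3 * x + s ≡ m + + 2
    index-up = trans (cong (λ t → t + + 3 * x + s) 2[1+n]) (up (+ (2 ℕ.* n)) x s)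
    index-down : + (2 ℕ.* suc n) + + 3 * (x - + 1) + s ≡ m - + 1
    index-down = trans (cong (λ t → t + + 3 * (x - + 1) + s) 2[1+n]) (down (+ (2 ℕ.* n)) x s)

  binomial-∇ : ∀ x j → binomial x (suc j) -ℚ binomial (x - + 1) (suc j) ≡ binomial x j
  binomial-∇ x j = begin
    binomial x (suc j) -ℚ binomial (x - + 1) (suc j)
      ≡⟨ cong (λ t → binomial x (suc j) -ℚ binomℤ t (suc j)) (shift x (+ j) c) ⟩
    binomℤ N (suc j) -ℚ binomℤ (N - + 1) (suc j)
      ≡⟨ binomℤ-pascal N j ⟩
    binomℤ (N - + 1) j
      ≡⟨ cong (λ t → binomℤ t j) (unshift x (+ j) c) ⟩
    binomial x j ∎
    where
    open ≡-Reasoning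
    N = x + + suc j - c
    shift : ∀ x j c → x - + 1 + (+ 1 + j) - c ≡ x + (+ 1 + j) - c - + 1
    shift = solve-∀
    unshift : ∀ x j c → x + (+ 1 + j) - c - + 1 ≡ x + j - c
    unshift = solve-∀

  correction-∇ : ∀ n x → correction (suc n) x -ℚ correction (suc n) (x - + 1) ≡ correction n x
  correction-∇ n x = begin
    correction (suc n) x -ℚ correction (suc n) (x - + 1)  ≡⟨ sumBelow-sub (suc n) _ _ ⟩
    sumBelow (suc n) term                                 ≡⟨ sumBelow-suc n term ⟩
    term 0 +ℚ sumBelow n (λ j → term (suc j))             ≡⟨ cong₂ _+ℚ_ (+-inverseʳ (coefficient (suc n) 0 *ℚ binomial x 0)) (sumBelow-cong n term-suc) ⟩
    0ℚ +ℚ correction n x                                  ≡⟨ +-identityˡ (correction n x) ⟩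
    correction n x                                        ∎
    where
    open ≡-Reasoning
    term : ℕ → ℚ
    term j = coefficient (suc n) j *ℚ binomial x j -ℚ coefficient (suc n) j *ℚ binomial (x - + 1) j
    factor : ∀ p q r → p *ℚ q -ℚ p *ℚ r ≡ p *ℚ (q -ℚ r)
    factor = solve 3 (λ p q r → p :* q :- p :* r := p :* (q :- r)) refl
    term-suc : ∀ j → term (suc j) ≡ coefficient n j *ℚ binomial x j
    term-suc j = trans (factor (coefficient n j) _ _) (cong (coefficient n j *ℚ_) (binomial-∇ x j))

  closedForm-∇ : ∀ n x → closedForm (suc n) x -ℚ closedForm (suc n) (x - + 1) ≡ closedForm n x
  closedForm-∇ n x = trans
    (interchange (leading (suc n) x) (correction (suc n) x) (leading (suc n) (x - + 1)) (correction (suc n) (x - + 1)))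
    (cong₂ _-ℚ_ (leading-∇ n x) (correction-∇ n x))
    where
    interchange : ∀ p q r t → (p -ℚ q) -ℚ (r -ℚ t) ≡ (p -ℚ r) -ℚ (q -ℚ t)
    interchange = solve 4 (λ p q r t → (p :- q) :- (r :- t) := (p :- r) :- (q :- t)) refl

  closedForm-vanishes : ∀ n → closedForm (suc n) (c - + 1) ≡ 0ℚ
  closedForm-vanishes n = begin
    leading (suc n) c₋₁ -ℚ correction (suc n) c₋₁
      ≡⟨ cong (leading (suc n) c₋₁ -ℚ_) (sumBelow-suc n (λ j → coefficient (suc n) j *ℚ binomial c₋₁ j)) ⟩
    leading (suc n) c₋₁ -ℚ (leading (suc n) c₋₁ *ℚ 1ℚ +ℚ sumBelow n (λ j → coefficient n j *ℚ binomial c₋₁ (suc j)))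
      ≡⟨ cong (λ t → leading (suc n) c₋₁ -ℚ (leading (suc n) c₋₁ *ℚ 1ℚ +ℚ t)) higher-terms ⟩
    leading (suc n) c₋₁ -ℚ (leading (suc n) c₋₁ *ℚ 1ℚ +ℚ 0ℚ)
      ≡⟨ cancel (leading (suc n) c₋₁) ⟩
    0ℚ ∎
    where
    open ≡-Reasoning
    c₋₁ = c - + 1
    binomial-vanishes : ∀ j → binomial c₋₁ (suc j) ≡ 0ℚ
    binomial-vanishes j = trans (cong (λ t → binomℤ t (suc j)) (offset c (+ j))) (binomℤ[n,1+n]≡0 j)
      where
      offset : ∀ c j → c - + 1 + (+ 1 + j) - c ≡ j
      offset = solve-∀
    cancel : ∀ p → p -ℚ (p *ℚ 1ℚ +ℚ 0ℚ) ≡ 0ℚ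
    cancel p = trans (cong (p -ℚ_) (trans (+-identityʳ (p *ℚ 1ℚ)) (*-identityʳ p))) (+-inverseʳ p)
    higher-terms : sumBelow n (λ j → coefficient n j *ℚ binomial c₋₁ (suc j)) ≡ 0ℚ
    higher-terms = trans (sumBelow-cong n (λ j → trans (cong (coefficient n j *ℚ_) (binomial-vanishes j))
                                                       (*-zeroʳ (coefficient n j))))
                         (sumBelow-zero n)

  iterSum-closedForm : ∀ n x → iterSum c n (λ a → toℚ (X (+ 3 * a + s))) x ≡ closedForm n x
  iterSum-closedForm zero x =
    sym (trans (+-identityʳ (leading 0 x)) (cong (λ t → toℚ (X (t + s))) (ℤP.+-identityˡ (+ 3 * x))))
  iterSum-closedForm (suc n) x = begin
    sumZ c x (iterSum c n _)                          ≡⟨ sumZ-cong (iterSum-closedForm n) c x ⟩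
    sumZ c x (closedForm n)                           ≡⟨ sumZ-telescope (closedForm n) (closedForm (suc n)) (λ y → sym (closedForm-∇ n y)) c x ⟩
    closedForm (suc n) x -ℚ closedForm (suc n) c₋₁   ≡⟨ cong (closedForm (suc n) x -ℚ_) (closedForm-vanishes n) ⟩
    closedForm (suc n) x -ℚ 0ℚ                        ≡⟨ +-identityʳ (closedForm (suc n) x) ⟩
    closedForm (suc n) x                              ∎
    where
    open ≡-Reasoning
    c₋₁ = c - + 1

theorem1 : (aₙ s c : ℤ) (n : ℕ) → .{{NonZero n}} →
    (iterSum c n (λ a₀ → toℚ (F (+ 3 * a₀ + s))) aₙ
      ≡ div2^ (F (+ (2 Data.Nat.* n) + + 3 * aₙ + s)) n
        -ℚ sumBelow n (λ j → div2^ (F (+ (2 Data.Nat.* (n ∸ j)) + + 3 * (c - + 1) + s)) (n ∸ j)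
                              *ℚ binomℤ (aₙ + + j - c) j))
    ×
    (iterSum c n (λ a₀ → toℚ (L (+ 3 * a₀ + s))) aₙ
      ≡ div2^ (L (+ (2 Data.Nat.* n) + + 3 * aₙ + s)) n
        -ℚ sumBelow n (λ j → div2^ (L (+ (2 Data.Nat.* (n ∸ j)) + + 3 * (c - + 1) + s)) (n ∸ j)
                              *ℚ binomℤ (aₙ + + j - c) j))
-- The identities hold for n = 0 as well.
theorem1 aₙ s c n =
    ClosedForm.iterSum-closedForm F (recSeq-fibonacci (+ 0) (+ 1)) s c n aₙ
  , ClosedForm.iterSum-closedForm L (recSeq-fibonacci (+ 2) (+ 1)) s c n aₙ
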